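{- For all finite types $\alpha,\beta$: $\mathsf{H}\text{ - }\mathsf{HA}^\omega\vdash\forall f:\alpha\to\beta.\;f=_{\alpha\to\beta}\lambda x:\alpha.fx$ (where $\lambda x:\alpha.fx$ is the term $\mathsf{s}(\mathsf{k}f)(\mathsf{s}\mathsf{k}\mathsf{k})$), and $\mathsf{H}\text{ - }\mathsf{HA}^\omega\vdash\mathsf{pair}(\mathsf{fst}\,x)(\mathsf{snd}\,x)=_{\alpha\times\beta}x$.
   Context: Finite types are generated by: $0$ is a type; if $\sigma,\tau$ are types, so are $\sigma\times\tau$ and $\sigma\to\tau$. $\mathsf{HA}^\omega$ is the many-sorted intuitionistic first-order theory whose sorts are the finite types. Its terms are built from variables and, for all types $\rho,\sigma,\tau$, the constants $\mathsf{k}:\rho\to\sigma\to\rho$, $\mathsf{s}:(\rho\to\sigma\to\tau)\to(\rho\to\sigma)\to(\rho\to\tau)$, $\mathsf{pair}:\sigma\to\tau\to\sigma\times\tau$, $\mathsf{fst}:\sigma\times\tau\to\sigma$, $\mathsf{snd}:\sigma\times\tau\to\tau$, $0:0$, $S:0\to0$, $\mathsf{R}:\sigma\to(0\to\sigma\to\sigma)\to0\to\sigma$, by application (associating to the left). Atomic formulas are $\bot$ and $s\equiv_\sigma t$. Axioms: $\equiv_\sigma$ is an equivalence relation; $x\equiv x'\to y\equiv y'\to xy\equiv x'y'$; $\mathsf{k}xy\equiv x$; $\mathsf{s}xyz\equiv xz(yz)$; $\mathsf{fst}(\mathsf{pair}\,xy)\equiv x$; $\mathsf{snd}(\mathsf{pair}\,xy)\equiv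 y$; $\mathsf{R}xy0\equiv x$; $\mathsf{R}xy(Sm)\equiv ym(\mathsf{R}xym)$; $Sx\equiv_0Sy\to x\equiv_0y$; $\neg(Sx\equiv_00)$; induction for all formulas. Surjective pairing ($\mathsf{pair}(\mathsf{fst}\,x)(\mathsf{snd}\,x)\equiv x$) is not assumed. The combinatory abstraction is $\lambda x.x:=\mathsf{s}\mathsf{k}\mathsf{k}$, $\lambda x.y:=\mathsf{k}y$ for a variable $y\neq x$, $\lambda x.c:=\mathsf{k}c$ for a constant $c$, $\lambda x.st:=\mathsf{s}(\lambda x.s)(\lambda x.t)$. $\mathsf{H}\text{ - }\mathsf{HA}^\omega$ extends the language with, for each type $\sigma$, a unary predicate $\mathrm{Ext}_\sigma$ and a binary predicate $=_\sigma$; $\forall^{\mathrm{Ext}}x:\sigma.\psi$ abbreviates $\forall x:\sigma(\mathrm{Ext}_\sigma(x)\to\psi)$. Its axioms are those of $\mathsf{HA}^\omega$, induction for all formulas of the extended language, and for all $\sigma,\tau$: $x=_0y\leftrightarrow x\equiv_0y$; $\forall x:0\,\mathrm{Ext}_0(x)$; $x=_{\sigma\times\tau}y\leftrightarrow(\mathsf{fst}\,x=_\sigma\mathsf{fst}\,y\wedge\mathsf{snd}\,x=_\tau\mathsf{snd}\,y)$; $\mathrm{Ext}_{\sigma\times\tau}(x)\leftrightarrow(\mathrm{Ext}_\sigma(\mathsf{fst}\,x)\wedge\mathrm{Ext}_\tau(\mathsf{snd}\,x))$; $f=_{\sigma\to\tau}g\leftrightarrow\forall^{\mathrm{Ext}}x:\sigma.fx=_\tau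 gx$; $\mathrm{Ext}_{\sigma\to\tau}(f)\to\mathrm{Ext}_\sigma(x)\to\mathrm{Ext}_\tau(fx)$; $x\equiv_\sigma y\to\mathrm{Ext}_\sigma(x)\to\mathrm{Ext}_\sigma(y)$; $\mathrm{Ext}(c)$ for each constant $c$. -}

module Defs where

open import Data.List using (List; []; _∷_; map)
open import Data.List.Membership.Propositional using (_∈_)

infixr 7 _⇒_
infixr 8 _⊗_

data Ty : Set where
  ι   : Ty
  _⊗_ : Ty → Ty → Ty
  _⇒_ : Ty → Ty → Ty

Ctx : Set
Ctx = List Ty

data Var : Ctx → Ty → Set where
  vz : ∀ {Γ σ} → Var (σ ∷ Γ) σ
  vs : ∀ {Γ σ τ} → Var Γ σ → Var (τ ∷ Γ) σ

data Const : Ty → Set where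
  K    : ∀ ρ σ → Const (ρ ⇒ σ ⇒ ρ)
  S    : ∀ ρ σ τ → Const ((ρ ⇒ σ ⇒ τ) ⇒ (ρ ⇒ σ) ⇒ (ρ ⇒ τ))
  PAIR : ∀ σ τ → Const (σ ⇒ τ ⇒ σ ⊗ τ)
  FST  : ∀ σ τ → Const (σ ⊗ τ ⇒ σ)
  SND  : ∀ σ τ → Const (σ ⊗ τ ⇒ τ)
  ZERO : Const ι
  SUCC : Const (ι ⇒ ι)
  REC  : ∀ σ → Const (σ ⇒ (ι ⇒ σ ⇒ σ) ⇒ ι ⇒ σ)

infixl 9 _·_
data Tm (Γ : Ctx) : Ty → Set where
  var : ∀ {σ} → Var Γ σ → Tm Γ σ
  con : ∀ {σ} → Const σ → Tm Γ σ
  _·_ : ∀ {σ τ} → Tm Γ (σ ⇒ τ) → Tm Γ σ → Tm Γ τ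

infixr 4 _⊃_
infixr 5 _∨'_
infixr 6 _∧'_
infix 7 _≣_ _≐_
data Fm (Γ : Ctx) : Set where
  ⊥'   : Fm Γ
  _≣_  : ∀ {σ} → Tm Γ σ → Tm Γ σ → Fm Γ   -- intensional equality ≡_σ
  _≐_  : ∀ {σ} → Tm Γ σ → Tm Γ σ → Fm Γ   -- extensional predicate =_σ
  Ext  : ∀ {σ} → Tm Γ σ → Fm Γ
  _∧'_ : Fm Γ → Fm Γ → Fm Γ
  _∨'_ : Fm Γ → Fm Γ → Fm Γ
  _⊃_  : Fm Γ → Fm Γ → Fm Γ
  All  : ∀ σ → Fm (σ ∷ Γ) → Fm Γ
  Ex   : ∀ σ → Fm (σ ∷ Γ) → Fm Γ

¬' : ∀ {Γ} → Fm Γ → Fm Γ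
¬' φ = φ ⊃ ⊥'

_⇔'_ : ∀ {Γ} → Fm Γ → Fm Γ → Fm Γ
φ ⇔' ψ = (φ ⊃ ψ) ∧' (ψ ⊃ φ)

Ren : Ctx → Ctx → Set
Ren Γ Δ = ∀ {σ} → Var Γ σ → Var Δ σ

liftR : ∀ {Γ Δ τ} → Ren Γ Δ → Ren (τ ∷ Γ) (τ ∷ Δ)
liftR ρ vz = vz
liftR ρ (vs x) = vs (ρ x)

renT : ∀ {Γ Δ σ} → Ren Γ Δ → Tm Γ σ → Tm Δ σ
renT ρ (var x) = var (ρ x)
renT ρ (con c) = con c
renT ρ (t · u) = renT ρ t · renT ρ u

renF : ∀ {Γ Δ} → Ren Γ Δ → Fm Γ → Fm Δ
renF ρ ⊥' = ⊥'
renF ρ (t ≣ u) = renT ρ t ≣ renT ρ u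
renF ρ (t ≐ u) = renT ρ t ≐ renT ρ u
renF ρ (Ext t) = Ext (renT ρ t)
renF ρ (φ ∧' ψ) = renF ρ φ ∧' renF ρ ψ
renF ρ (φ ∨' ψ) = renF ρ φ ∨' renF ρ ψ
renF ρ (φ ⊃ ψ) = renF ρ φ ⊃ renF ρ ψ
renF ρ (All σ φ) = All σ (renF (liftR ρ) φ)
renF ρ (Ex σ φ) = Ex σ (renF (liftR ρ) φ)

wkF : ∀ {Γ τ} → Fm Γ → Fm (τ ∷ Γ)
wkF = renF vs

wkT : ∀ {Γ σ τ} → Tm Γ σ → Tm (τ ∷ Γ) σ
wkT = renT vs

Sub : Ctx → Ctx → Set
Sub Γ Δ = ∀ {σ} → Var Γ σ → Tm Δ σ

liftS : ∀ {Γ Δ τ} → Sub Γ Δ → Sub (τ ∷ Γ) (τ ∷ Δ)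
liftS θ vz = var vz
liftS θ (vs x) = wkT (θ x)

subT : ∀ {Γ Δ σ} → Sub Γ Δ → Tm Γ σ → Tm Δ σ
subT θ (var x) = θ x
subT θ (con c) = con c
subT θ (t · u) = subT θ t · subT θ u

subF : ∀ {Γ Δ} → Sub Γ Δ → Fm Γ → Fm Δ
subF θ ⊥' = ⊥'
subF θ (t ≣ u) = subT θ t ≣ subT θ u
subF θ (t ≐ u) = subT θ t ≐ subT θ u
subF θ (Ext t) = Ext (subT θ t)
subF θ (φ ∧' ψ) = subF θ φ ∧' subF θ ψ
subF θ (φ ∨' ψ) = subF θ φ ∨' subF θ ψ
subF θ (φ ⊃ ψ) = subF θ φ ⊃ subF θ ψ
subF θ (All σ φ) = All σ (subF (liftS θ) φ)
subF θ (Ex σ φ) = Ex σ (subF (liftS θ) φ)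

sub0 : ∀ {Γ σ} → Tm Γ σ → Sub (σ ∷ Γ) Γ
sub0 t vz = t
sub0 t (vs x) = var x

_[_] : ∀ {Γ σ} → Fm (σ ∷ Γ) → Tm Γ σ → Fm Γ
φ [ t ] = subF (sub0 t) φ

_[_]' : ∀ {Γ σ} → Fm (σ ∷ Γ) → Tm (σ ∷ Γ) σ → Fm (σ ∷ Γ)
φ [ t ]' = subF (λ { vz → t ; (vs x) → var (vs x) }) φ

k : ∀ {Γ ρ σ} → Tm Γ (ρ ⇒ σ ⇒ ρ)
k = con (K _ _)
s : ∀ {Γ ρ σ τ} → Tm Γ ((ρ ⇒ σ ⇒ τ) ⇒ (ρ ⇒ σ) ⇒ (ρ ⇒ τ))
s = con (S _ _ _)
pair : ∀ {Γ σ τ} → Tm Γ (σ ⇒ τ ⇒ σ ⊗ τ)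
pair = con (PAIR _ _)
fst : ∀ {Γ σ τ} → Tm Γ (σ ⊗ τ ⇒ σ)
fst = con (FST _ _)
snd : ∀ {Γ σ τ} → Tm Γ (σ ⊗ τ ⇒ τ)
snd = con (SND _ _)
zero' : ∀ {Γ} → Tm Γ ι
zero' = con ZERO
suc' : ∀ {Γ} → Tm Γ ι → Tm Γ ι
suc' t = con SUCC · t
R : ∀ {Γ σ} → Tm Γ (σ ⇒ (ι ⇒ σ ⇒ σ) ⇒ ι ⇒ σ)
R = con (REC _)

Iα : ∀ {Γ} α → Tm Γ (α ⇒ α)
Iα α = con (S α (α ⇒ α) α) · con (K α (α ⇒ α)) · con (K α α)

-- Axioms of H-HA^ω, as schemata over arbitrary terms in context Γ
-- (equivalent to their universal closures).
data Axiom {Γ : Ctx} : Fm Γ → Set where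
  eq-refl  : ∀ {σ} (x : Tm Γ σ) → Axiom (x ≣ x)
  eq-sym   : ∀ {σ} (x y : Tm Γ σ) → Axiom (x ≣ y ⊃ y ≣ x)
  eq-trans : ∀ {σ} (x y z : Tm Γ σ) → Axiom (x ≣ y ⊃ y ≣ z ⊃ x ≣ z)
  eq-app   : ∀ {σ τ} (x x' : Tm Γ (σ ⇒ τ)) (y y' : Tm Γ σ) →
             Axiom (x ≣ x' ⊃ y ≣ y' ⊃ (x · y) ≣ (x' · y'))
  ax-k   : ∀ {ρ σ} (x : Tm Γ ρ) (y : Tm Γ σ) → Axiom ((k · x · y) ≣ x)
  ax-s   : ∀ {ρ σ τ} (x : Tm Γ (ρ ⇒ σ ⇒ τ)) (y : Tm Γ (ρ ⇒ σ)) (z : Tm Γ ρ) →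
           Axiom ((s · x · y · z) ≣ (x · z · (y · z)))
  ax-fst : ∀ {σ τ} (x : Tm Γ σ) (y : Tm Γ τ) → Axiom ((fst · (pair · x · y)) ≣ x)
  ax-snd : ∀ {σ τ} (x : Tm Γ σ) (y : Tm Γ τ) → Axiom ((snd · (pair · x · y)) ≣ y)
  ax-R0  : ∀ {σ} (x : Tm Γ σ) (y : Tm Γ (ι ⇒ σ ⇒ σ)) → Axiom ((R · x · y · zero') ≣ x)
  ax-RS  : ∀ {σ} (x : Tm Γ σ) (y : Tm Γ (ι ⇒ σ ⇒ σ)) (m : Tm Γ ι) →
           Axiom ((R · x · y · suc' m) ≣ (y · m · (R · x · y · m)))
  ax-Sinj : (x y : Tm Γ ι) → Axiom (suc' x ≣ suc' y ⊃ x ≣ y)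
  ax-S≠0  : (x : Tm Γ ι) → Axiom (¬' (suc' x ≣ zero'))
  ax-ind : (φ : Fm (ι ∷ Γ)) →
           Axiom (φ [ zero' ] ⊃ All ι (φ ⊃ φ [ suc' (var vz) ]') ⊃ All ι φ)
  ax-=0     : (x y : Tm Γ ι) → Axiom ((x ≐ y) ⇔' (x ≣ y))
  ax-Ext0   : (x : Tm Γ ι) → Axiom (Ext x)
  ax-=×     : ∀ {σ τ} (x y : Tm Γ (σ ⊗ τ)) →
              Axiom ((x ≐ y) ⇔' (((fst · x) ≐ (fst · y)) ∧' ((snd · x) ≐ (snd · y))))
  ax-Ext×   : ∀ {σ τ} (x : Tm Γ (σ ⊗ τ)) →
              Axiom (Ext x ⇔' (Ext (fst · x) ∧' Ext (snd · x)))
  ax-=⇒     : ∀ {σ τ} (f g : Tm Γ (σ ⇒ τ)) →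
              Axiom ((f ≐ g) ⇔' All σ (Ext (var vz) ⊃ ((wkT f · var vz) ≐ (wkT g · var vz))))
  ax-Ext⇒   : ∀ {σ τ} (f : Tm Γ (σ ⇒ τ)) (x : Tm Γ σ) →
              Axiom (Ext f ⊃ Ext x ⊃ Ext (f · x))
  ax-Ext≡   : ∀ {σ} (x y : Tm Γ σ) → Axiom (x ≣ y ⊃ Ext x ⊃ Ext y)
  ax-ExtC   : ∀ {σ} (c : Const σ) → Axiom (Ext (con c))

infix 2 _∣_⊢_
data _∣_⊢_ (Γ : Ctx) (Δ : List (Fm Γ)) : Fm Γ → Set where
  ax   : ∀ {φ} → Axiom φ → Γ ∣ Δ ⊢ φ
  hyp  : ∀ {φ} → φ ∈ Δ → Γ ∣ Δ ⊢ φ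
  ⊥E   : ∀ {φ} → Γ ∣ Δ ⊢ ⊥' → Γ ∣ Δ ⊢ φ
  ⊃I   : ∀ {φ ψ} → Γ ∣ φ ∷ Δ ⊢ ψ → Γ ∣ Δ ⊢ φ ⊃ ψ
  ⊃E   : ∀ {φ ψ} → Γ ∣ Δ ⊢ φ ⊃ ψ → Γ ∣ Δ ⊢ φ → Γ ∣ Δ ⊢ ψ
  ∧I   : ∀ {φ ψ} → Γ ∣ Δ ⊢ φ → Γ ∣ Δ ⊢ ψ → Γ ∣ Δ ⊢ φ ∧' ψ
  ∧E₁  : ∀ {φ ψ} → Γ ∣ Δ ⊢ φ ∧' ψ → Γ ∣ Δ ⊢ φ
  ∧E₂  : ∀ {φ ψ} → Γ ∣ Δ ⊢ φ ∧' ψ → Γ ∣ Δ ⊢ ψ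
  ∨I₁  : ∀ {φ ψ} → Γ ∣ Δ ⊢ φ → Γ ∣ Δ ⊢ φ ∨' ψ
  ∨I₂  : ∀ {φ ψ} → Γ ∣ Δ ⊢ ψ → Γ ∣ Δ ⊢ φ ∨' ψ
  ∨E   : ∀ {φ ψ χ} → Γ ∣ Δ ⊢ φ ∨' ψ → Γ ∣ φ ∷ Δ ⊢ χ → Γ ∣ ψ ∷ Δ ⊢ χ → Γ ∣ Δ ⊢ χ
  ∀I   : ∀ {σ φ} → (σ ∷ Γ) ∣ map wkF Δ ⊢ φ → Γ ∣ Δ ⊢ All σ φ
  ∀E   : ∀ {σ φ} → Γ ∣ Δ ⊢ All σ φ → (t : Tm Γ σ) → Γ ∣ Δ ⊢ φ [ t ]
  ∃I   : ∀ {σ φ} (t : Tm Γ σ) → Γ ∣ Δ ⊢ φ [ t ] → Γ ∣ Δ ⊢ Ex σ φ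
  ∃E   : ∀ {σ φ ψ} → Γ ∣ Δ ⊢ Ex σ φ → (σ ∷ Γ) ∣ φ ∷ map wkF Δ ⊢ wkF ψ → Γ ∣ Δ ⊢ ψ

H-HAω⊢ : ∀ Γ → Fm Γ → Set
H-HAω⊢ Γ φ = Γ ∣ [] ⊢ φ

-- The extensional equality =_σ contains the intensional equality ≡_σ at every type σ, by induction
-- on σ: at 0 this is an axiom, and at σ × τ and σ → τ the defining axiom of =_σ reduces it to the
-- components fst, snd, resp. to the applications f x, which are ≡ by congruence.  Both claims are
-- therefore extensional consequences of intensional facts: (λx.f x) x ≡ f x by the s- and k-axioms,
-- and fst, snd of pair (fst x) (snd x) are ≡ to fst x, snd x by the projection axioms.
module Submission where

open import Defs
open import Data.List using (List; []; _∷_; map)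
open import Data.Product using (_×_; _,_)
open import Data.List.Relation.Unary.Any using (here; there)
open import Relation.Binary.PropositionalEquality using (refl)

module _ {Γ : Ctx} {Δ : List (Fm Γ)} where

  ≣-refl : ∀ {σ} (x : Tm Γ σ) → Γ ∣ Δ ⊢ x ≣ x
  ≣-refl x = ax (eq-refl x)

  ≣-sym : ∀ {σ} {x y : Tm Γ σ} → Γ ∣ Δ ⊢ x ≣ y → Γ ∣ Δ ⊢ y ≣ x
  ≣-sym {x = x} {y} x≣y = ⊃E (ax (eq-sym x y)) x≣y

  ≣-trans : ∀ {σ} {x y z : Tm Γ σ} → Γ ∣ Δ ⊢ x ≣ y → Γ ∣ Δ ⊢ y ≣ z → Γ ∣ Δ ⊢ x ≣ z
  ≣-trans {x = x} {y} {z} x≣y y≣z = ⊃E (⊃E (ax (eq-trans x y z)) x≣y) y≣z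

  ≣-cong-· : ∀ {σ τ} {f g : Tm Γ (σ ⇒ τ)} {x y : Tm Γ σ} →
             Γ ∣ Δ ⊢ f ≣ g → Γ ∣ Δ ⊢ x ≣ y → Γ ∣ Δ ⊢ (f · x) ≣ (g · y)
  ≣-cong-· {f = f} {g} {x} {y} f≣g x≣y = ⊃E (⊃E (ax (eq-app f g x y)) f≣g) x≣y

  ≣-congˡ : ∀ {σ τ} (f : Tm Γ (σ ⇒ τ)) {x y : Tm Γ σ} →
            Γ ∣ Δ ⊢ x ≣ y → Γ ∣ Δ ⊢ (f · x) ≣ (f · y)
  ≣-congˡ f = ≣-cong-· (≣-refl f)

  ≐⊗-intro : ∀ {σ τ} {x y : Tm Γ (σ ⊗ τ)} →
             Γ ∣ Δ ⊢ (fst · x) ≐ (fst · y) → Γ ∣ Δ ⊢ (snd · x) ≐ (snd · y) → Γ ∣ Δ ⊢ x ≐ y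
  ≐⊗-intro fst≐ snd≐ = ⊃E (∧E₂ (ax (ax-=× _ _))) (∧I fst≐ snd≐)

  ≐⇒-intro : ∀ {σ τ} {f g : Tm Γ (σ ⇒ τ)} →
             (σ ∷ Γ) ∣ Ext (var vz) ∷ map wkF Δ ⊢ (wkT f · var vz) ≐ (wkT g · var vz) →
             Γ ∣ Δ ⊢ f ≐ g
  ≐⇒-intro fx≐gx = ⊃E (∧E₂ (ax (ax-=⇒ _ _))) (∀I (⊃I fx≐gx))

≣⊃≐ : ∀ σ {Γ} {Δ : List (Fm Γ)} (x y : Tm Γ σ) → Γ ∣ Δ ⊢ x ≣ y ⊃ x ≐ y
≣⊃≐ ι x y = ∧E₂ (ax (ax-=0 x y))
≣⊃≐ (σ ⊗ τ) x y = ⊃I (≐⊗-intro (⊃E (≣⊃≐ σ _ _) (≣-congˡ fst x≣y))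
                               (⊃E (≣⊃≐ τ _ _) (≣-congˡ snd x≣y)))
  where x≣y = hyp (here refl)
≣⊃≐ (σ ⇒ τ) x y = ⊃I (≐⇒-intro (⊃E (≣⊃≐ τ _ _) (≣-cong-· wk-x≣y (≣-refl (var vz)))))
  where wk-x≣y = hyp (there (here refl))

≣⇒≐ : ∀ {σ Γ} {Δ : List (Fm Γ)} {x y : Tm Γ σ} → Γ ∣ Δ ⊢ x ≣ y → Γ ∣ Δ ⊢ x ≐ y
≣⇒≐ {σ} = ⊃E (≣⊃≐ σ _ _)

Iα-β : ∀ α {Γ} {Δ : List (Fm Γ)} (x : Tm Γ α) → Γ ∣ Δ ⊢ (Iα α · x) ≣ x
Iα-β α x = ≣-trans (ax (ax-s _ _ _)) (ax (ax-k _ _))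

η-β : ∀ {α β Γ} {Δ : List (Fm Γ)} (f : Tm Γ (α ⇒ β)) (x : Tm Γ α) →
      Γ ∣ Δ ⊢ (s · (k · f) · Iα α · x) ≣ (f · x)
η-β {α} f x = ≣-trans (ax (ax-s _ _ _)) (≣-cong-· (ax (ax-k _ _)) (Iα-β α x))

lemma2p8 : (α β : Ty) →
    H-HAω⊢ [] (All (α ⇒ β) (var vz ≐ (s · (k · var vz) · Iα α)))
    × H-HAω⊢ (α ⊗ β ∷ []) ((pair · (fst · var vz) · (snd · var vz)) ≐ var vz)
lemma2p8 α β =
    ∀I (≐⇒-intro (≣⇒≐ (≣-sym (η-β _ _))))
  , ≐⊗-intro (≣⇒≐ (ax (ax-fst _ _))) (≣⇒≐ (ax (ax-snd _ _)))
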